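{- Let $G$ be a locally finite graph and let $f$ be a non-negative integer. Then $G$ has the $(\{f\},1)$-containment property (constant sequence $f_n=f$) if and only if $G$ has the $(\{rf\},r)$-containment property (constant sequence $rf$) for every integer $r\geq 1$.
   Context: Let $G$ be a graph, $r$ a positive integer and $\{f_n\}_{n\ge1}$ a sequence of non-negative integers. Given a finite set $X_0$ of vertices, a sequence $\{W_k\}_{k\geq1}$ of vertex sets is an $(\{f_n\},r)$-containment strategy for $X_0$ if: (1) $|W_n|\le f_n$ for all $n\ge1$; (2) $X_n\cap W_{n+1}=\emptyset$ for all $n\ge 0$, where for $n>0$, $X_n$ is the set of vertices connected to a vertex of $X_{n-1}$ by a path of length at most $r$ containing no vertex of $W_1\cup\cdots\cup W_n$; (3) there is $N>0$ with $X_n=X_N$ for all $n\ge N$. $G$ has the $(\{f_n\},r)$-containment property if every finite set of vertices admits such a strategy. -}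

module Defs where

open import Data.Nat using (ℕ; zero; suc; _≤_; _<_; _≥_; _>_)
open import Data.List using (List; []; _∷_; [_]; _++_; length)
open import Data.List.Membership.Propositional using (_∈_; _∉_)
open import Data.List.Relation.Unary.All using (All)
open import Data.List.Relation.Unary.Unique.Propositional using (Unique)
open import Data.Product using (Σ; ∃; _×_; _,_)
open import Relation.Binary.PropositionalEquality using (_≡_)
open import Relation.Nullary using (¬_)
open import Function.Bundles using (_⇔_)

record Graph : Set₁ where
  field
    V     : Set
    E     : V → V → Set
    sym   : ∀ {u v} → E u v → E v u
    irref : ∀ {u} → ¬ E u u

module _ (G : Graph) where
  open Graph G

  LocallyFinite : Set
  LocallyFinite = ∀ v → Σ (List V) λ ns → ∀ w → E v w → w ∈ ns

  data Walk : V → V → List V → Set where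
    here : ∀ {u} → Walk u u [ u ]
    step : ∀ {u w v vs} → E u w → Walk w v vs → Walk u v (u ∷ vs)

  -- A path of length at most r from u to v avoiding every vertex of the list B:
  -- vertex sequence vs of a walk, with no repeated vertex, at most r edges
  -- (i.e. at most r+1 vertices), and no vertex in B.
  AvoidingPath : ℕ → List V → V → V → Set
  AvoidingPath r B u v =
    Σ (List V) λ vs → Walk u v vs × Unique vs × length vs ≤ suc r × All (_∉ B) vs

  -- W_1 ∪ ... ∪ W_n  (W 0 is never used)
  Upto : (ℕ → List V) → ℕ → List V
  Upto W zero    = []
  Upto W (suc n) = Upto W n ++ W (suc n)

  X : ℕ → List V → (ℕ → List V) → ℕ → V → Set
  X r X₀ W zero    v = v ∈ X₀
  X r X₀ W (suc n) v =
    ∃ λ u → X r X₀ W n u × AvoidingPath r (Upto W (suc n)) u v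

  -- ({f_n}, r)-containment strategy for X₀ (f and W are indexed from 1).
  IsContainmentStrategy : (ℕ → ℕ) → ℕ → List V → (ℕ → List V) → Set
  IsContainmentStrategy f r X₀ W =
      (∀ n → n ≥ 1 → length (W n) ≤ f n)
    × (∀ n v → X r X₀ W n v → v ∉ W (suc n))
    × (∃ λ N → N > 0 × (∀ n → n ≥ N → ∀ v → X r X₀ W n v ⇔ X r X₀ W N v))

  ContainmentProperty : (ℕ → ℕ) → ℕ → Set
  ContainmentProperty f r =
    ∀ (X₀ : List V) → ∃ λ (W : ℕ → List V) → IsContainmentStrategy f r X₀ W

{-# OPTIONS --safe #-}
-- Given a ({f},1)-strategy W, protect in round n of the radius-r game the
-- vertices W_{(n-1)r+1} ∪ ... ∪ W_{nr}, at most r·f of them; after n rounds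
-- exactly W_1 ∪ ... ∪ W_{nr} is protected. A path of length at most r avoiding
-- these vertices can be followed one edge per round by the radius-1 fire, so the
-- radius-r fire after n rounds lies inside the radius-1 fire after nr rounds.
-- Conversely a burning vertex is never protected, so the radius-1 fire after n
-- rounds lies inside the radius-r fire after n rounds. The two fires therefore
-- stabilise together. The converse implication is the case r = 1.
module Submission where

open import Defs
open import Data.Nat using (ℕ; zero; suc; _+_; _*_; _≤_; _≥_; _≤′_; ≤′-refl; ≤′-step; z≤n; s≤s; _≤?_; NonZero; >-nonZero)
open import Data.Nat.Properties
open import Data.List using (List; []; _∷_; _++_; length)
open import Data.List.Properties using (length-++; ++-assoc; ++-identityʳ)
open import Data.List.Membership.Propositional using (_∈_; _∉_)
open import Data.List.Membership.Propositional.Properties using (∈-++⁻; ∈-++⁺ˡ; ∈-++⁺ʳ)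
open import Data.List.Relation.Unary.All as All using (All; []; _∷_)
open import Data.List.Relation.Unary.Any using (here; there)
open import Data.List.Relation.Unary.AllPairs using ([]; _∷_)
open import Data.List.Relation.Unary.Unique.Propositional using (Unique)
open import Data.Product using (_,_)
open import Data.Sum using (_⊎_; inj₁; inj₂)
open import Function.Bundles using (_⇔_; mk⇔; Equivalence)
open import Relation.Binary.PropositionalEquality
  using (_≡_; refl; sym; trans; cong; subst; module ≡-Reasoning)
open import Relation.Nullary using (yes; no)

module _ (G : Graph) where
  open Graph G hiding (sym)

  Walk-last∈ : ∀ {u v vs} → Walk G u v vs → v ∈ vs
  Walk-last∈ here       = here refl
  Walk-last∈ (step _ w) = there (Walk-last∈ w)

  Walk-head∈ : ∀ {u v vs} → Walk G u v vs → u ∈ vs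
  Walk-head∈ here       = here refl
  Walk-head∈ (step _ _) = here refl

  Walk-length≤2⇒endpoints : ∀ {u v vs} → Walk G u v vs → length vs ≤ 2 →
                            All (λ x → x ≡ u ⊎ x ≡ v) vs
  Walk-length≤2⇒endpoints here                         _ = inj₁ refl ∷ []
  Walk-length≤2⇒endpoints (step _ here)                _ = inj₁ refl ∷ inj₂ refl ∷ []
  Walk-length≤2⇒endpoints (step _ (step _ here))       (s≤s (s≤s ()))
  Walk-length≤2⇒endpoints (step _ (step _ (step _ _))) (s≤s (s≤s ()))

  edge-unique : ∀ {u w} → E u w → Unique (u ∷ w ∷ [])
  edge-unique {u} e = ((λ u≡w → irref (subst (E u) (sym u≡w) e)) ∷ []) ∷ [] ∷ []

  Upto-mono : ∀ W {x m n} → m ≤ n → x ∈ Upto G W m → x ∈ Upto G W n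
  Upto-mono W m≤n = go (≤⇒≤′ m≤n)
    where
    go : ∀ {x m n} → m ≤′ n → x ∈ Upto G W m → x ∈ Upto G W n
    go ≤′-refl        x∈ = x∈
    go (≤′-step m≤′n) x∈ = ∈-++⁺ˡ (go m≤′n x∈)

  ∉-Upto : ∀ W {x} → (∀ j → x ∉ W (suc j)) → ∀ n → x ∉ Upto G W n
  ∉-Upto W x∉W (suc n) x∈ with ∈-++⁻ (Upto G W n) x∈
  ... | inj₁ x∈Upto = ∉-Upto W x∉W n x∈Upto
  ... | inj₂ x∈W    = x∉W n x∈W

  Segment : (ℕ → List V) → ℕ → ℕ → List V
  Segment W b zero    = []
  Segment W b (suc i) = Segment W b i ++ W (suc (b + i))

  Upto-+ : ∀ W b i → Upto G W (b + i) ≡ Upto G W b ++ Segment W b i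
  Upto-+ W b zero = trans (cong (Upto G W) (+-identityʳ b)) (sym (++-identityʳ (Upto G W b)))
  Upto-+ W b (suc i) = begin
    Upto G W (b + suc i)                                ≡⟨ cong (Upto G W) (+-suc b i) ⟩
    Upto G W (b + i) ++ W (suc (b + i))                 ≡⟨ cong (_++ W (suc (b + i))) (Upto-+ W b i) ⟩
    (Upto G W b ++ Segment W b i) ++ W (suc (b + i))    ≡⟨ ++-assoc (Upto G W b) _ _ ⟩
    Upto G W b ++ Segment W b (suc i)                   ∎
    where open ≡-Reasoning

  Segment-length : ∀ {f} W → (∀ n → n ≥ 1 → length (W n) ≤ f) →
                   ∀ b i → length (Segment W b i) ≤ i * f
  Segment-length     W bounded b zero    = z≤n
  Segment-length {f} W bounded b (suc i) = begin
    length (Segment W b i ++ W (suc (b + i)))           ≡⟨ length-++ (Segment W b i) ⟩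
    length (Segment W b i) + length (W (suc (b + i)))   ≤⟨ +-mono-≤ (Segment-length W bounded b i) (bounded _ (s≤s z≤n)) ⟩
    i * f + f                                           ≡⟨ +-comm (i * f) f ⟩
    suc i * f                                           ∎
    where open ≤-Reasoning

  Grouped : ℕ → (ℕ → List V) → ℕ → List V
  Grouped r W zero    = []
  Grouped r W (suc n) = Segment W (n * r) r

  Upto-Grouped : ∀ r W n → Upto G (Grouped r W) n ≡ Upto G W (n * r)
  Upto-Grouped r W zero    = refl
  Upto-Grouped r W (suc n) = begin
    Upto G (Grouped r W) n ++ Segment W (n * r) r  ≡⟨ cong (_++ Segment W (n * r) r) (Upto-Grouped r W n) ⟩
    Upto G W (n * r) ++ Segment W (n * r) r        ≡⟨ Upto-+ W (n * r) r ⟨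
    Upto G W (n * r + r)                           ≡⟨ cong (Upto G W) (+-comm (n * r) r) ⟩
    Upto G W (suc n * r)                           ∎
    where open ≡-Reasoning

  ∉-Upto-Grouped : ∀ r W {x} → (∀ j → x ∉ W (suc j)) → ∀ n → x ∉ Upto G (Grouped r W) n
  ∉-Upto-Grouped r W {x} x∉W n =
    subst (x ∉_) (sym (Upto-Grouped r W n)) (∉-Upto W x∉W (n * r))

  DisjointXW : ℕ → List V → (ℕ → List V) → Set
  DisjointXW r X₀ W = ∀ n v → X G r X₀ W n v → v ∉ W (suc n)

  X-∉-Upto : ∀ {r X₀ W} n {v} → X G r X₀ W n v → v ∉ Upto G W n
  X-∉-Upto (suc n) (_ , _ , _ , walk , _ , _ , vs∉) = All.lookup vs∉ (Walk-last∈ walk)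

  module _ {r X₀ W} (disjoint : DisjointXW r X₀ W) where

    X-suc : ∀ n {v} → X G r X₀ W n v → X G r X₀ W (suc n) v
    X-suc n {v} xv = v , xv , _ , here , [] ∷ [] , s≤s z≤n , v∉ ∷ []
      where
      v∉ : v ∉ Upto G W n ++ W (suc n)
      v∉ v∈ with ∈-++⁻ (Upto G W n) v∈
      ... | inj₁ v∈Upto = X-∉-Upto n xv v∈Upto
      ... | inj₂ v∈W    = disjoint n v xv v∈W

    X-mono : ∀ {m n v} → m ≤ n → X G r X₀ W m v → X G r X₀ W n v
    X-mono m≤n = go (≤⇒≤′ m≤n)
      where
      go : ∀ {m n v} → m ≤′ n → X G r X₀ W m v → X G r X₀ W n v
      go ≤′-refl        xv = xv
      go (≤′-step m≤′n) xv = X-suc _ (go m≤′n xv)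

    X-∉-W : ∀ {n v} → X G r X₀ W n v → ∀ j → v ∉ W (suc j)
    X-∉-W {n} {v} xv j v∈ with n ≤? j
    ... | yes n≤j = disjoint j v (X-mono n≤j xv) v∈
    ... | no  n≰j = X-∉-Upto n xv (Upto-mono W (≰⇒> n≰j) (∈-++⁺ʳ (Upto G W j) v∈))

  X₁-edge : ∀ {X₀ W k u w} → X G 1 X₀ W k u → E u w →
            u ∉ Upto G W (suc k) → w ∉ Upto G W (suc k) → X G 1 X₀ W (suc k) w
  X₁-edge xu e u∉ w∉ = _ , xu , _ , step e here , edge-unique e , ≤-refl , u∉ ∷ w∉ ∷ []

  X₁-walk : ∀ {X₀ W} → DisjointXW 1 X₀ W →
            ∀ {k ℓ u v vs} → X G 1 X₀ W k u → Walk G u v vs → length vs ≤ suc ℓ →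
            All (_∉ Upto G W (k + ℓ)) vs → X G 1 X₀ W (k + ℓ) v
  X₁-walk disjoint {k} {ℓ} xu here _ _ = X-mono disjoint (m≤m+n k ℓ) xu
  X₁-walk disjoint {ℓ = zero} xu (step _ here)       (s≤s ())
  X₁-walk disjoint {ℓ = zero} xu (step _ (step _ _)) (s≤s ())
  X₁-walk {W = W} disjoint {k} {suc ℓ} xu (step e walk) (s≤s len) (u∉ ∷ vs∉) rewrite +-suc k ℓ =
    X₁-walk disjoint (X₁-edge xu e (narrow u∉) (narrow (All.lookup vs∉ (Walk-head∈ walk)))) walk len vs∉
    where
    narrow : ∀ {x} → x ∉ Upto G W (suc (k + ℓ)) → x ∉ Upto G W (suc k)
    narrow x∉ x∈ = x∉ (Upto-mono W (s≤s (m≤m+n k ℓ)) x∈)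

  module _ {r : ℕ} {X₀ W} (disjoint : DisjointXW 1 X₀ W) where

    Xᵣ-Grouped⊆X₁ : ∀ n {v} → X G r X₀ (Grouped r W) n v → X G 1 X₀ W (n * r) v
    Xᵣ-Grouped⊆X₁ zero    xv = xv
    Xᵣ-Grouped⊆X₁ (suc n) {v} (_ , xu , _ , walk , _ , len , vs∉) =
      subst (λ m → X G 1 X₀ W m v) (+-comm (n * r) r)
        (X₁-walk disjoint (Xᵣ-Grouped⊆X₁ n xu) walk len (All.map widen vs∉))
      where
      widen : ∀ {x} → x ∉ Upto G (Grouped r W) (suc n) → x ∉ Upto G W (n * r + r)
      widen {x} = subst (λ U → x ∉ U)
        (trans (Upto-Grouped r W (suc n)) (cong (Upto G W) (+-comm r (n * r))))

    X₁⊆Xᵣ-Grouped : r ≥ 1 → ∀ n {v} → X G 1 X₀ W n v → X G r X₀ (Grouped r W) n v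
    X₁⊆Xᵣ-Grouped r≥1 zero    xv = xv
    X₁⊆Xᵣ-Grouped r≥1 (suc n) {v} xv@(u , xu , vs , walk , unique , len , _) =
      u , X₁⊆Xᵣ-Grouped r≥1 n xu , vs , walk , unique , ≤-trans len (s≤s r≥1) ,
      All.map unprotected (Walk-length≤2⇒endpoints walk len)
      where
      unprotected : ∀ {x} → x ≡ u ⊎ x ≡ v → x ∉ Upto G (Grouped r W) (suc n)
      unprotected (inj₁ refl) = ∉-Upto-Grouped r W (X-∉-W disjoint xu) (suc n)
      unprotected (inj₂ refl) = ∉-Upto-Grouped r W (X-∉-W disjoint xv) (suc n)

    Grouped-disjoint : DisjointXW r X₀ (Grouped r W)
    Grouped-disjoint n v xv v∈ =
      ∉-Upto-Grouped r W (X-∉-W disjoint (Xᵣ-Grouped⊆X₁ n xv)) (suc n)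
        (∈-++⁺ʳ (Upto G (Grouped r W) n) v∈)

  Grouped-strategy : ∀ {f r X₀ W} → r ≥ 1 →
                     IsContainmentStrategy G (λ _ → f) 1 X₀ W →
                     IsContainmentStrategy G (λ _ → r * f) r X₀ (Grouped r W)
  Grouped-strategy {f} {r} {X₀} {W} r≥1 (bounded , disjoint , N , N>0 , stable) =
    bounded′ , Grouped-disjoint disjoint , N , N>0 , stable′
    where
    instance
      r≢0 : NonZero r
      r≢0 = >-nonZero r≥1

    bounded′ : ∀ n → n ≥ 1 → length (Grouped r W n) ≤ r * f
    bounded′ (suc n) _ = Segment-length W bounded (n * r) r

    stable′ : ∀ n → n ≥ N → ∀ v → X G r X₀ (Grouped r W) n v ⇔ X G r X₀ (Grouped r W) N v
    stable′ n n≥N v = mk⇔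
      (λ xv → X₁⊆Xᵣ-Grouped disjoint r≥1 N
        (Equivalence.to (stable (n * r) (≤-trans n≥N (m≤m*n n r)) v) (Xᵣ-Grouped⊆X₁ disjoint n xv)))
      (X-mono (Grouped-disjoint disjoint) n≥N)

  IsContainmentStrategy-weaken : ∀ {f g r X₀ W} → (∀ n → f n ≤ g n) →
                                 IsContainmentStrategy G f r X₀ W → IsContainmentStrategy G g r X₀ W
  IsContainmentStrategy-weaken f≤g (bounded , rest) = (λ n n≥1 → ≤-trans (bounded n n≥1) (f≤g n)) , rest

corollary1p8 : (G : Graph) → LocallyFinite G → (f : ℕ) →
    (ContainmentProperty G (λ _ → f) 1
      ⇔ (∀ (r : ℕ) → r ≥ 1 → ContainmentProperty G (λ _ → r * f) r))
corollary1p8 G _ f = mk⇔ radius-r radius-1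
  where
  radius-r : ContainmentProperty G (λ _ → f) 1 → ∀ r → r ≥ 1 → ContainmentProperty G (λ _ → r * f) r
  radius-r contain r r≥1 X₀ =
    let W , strategy = contain X₀ in Grouped G r W , Grouped-strategy G r≥1 strategy

  radius-1 : (∀ r → r ≥ 1 → ContainmentProperty G (λ _ → r * f) r) → ContainmentProperty G (λ _ → f) 1
  radius-1 contain X₀ =
    let W , strategy = contain 1 ≤-refl X₀
    in W , IsContainmentStrategy-weaken G (λ _ → ≤-reflexive (*-identityˡ f)) strategy
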